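{- Let $M$ be a positive integer. Then $\sigma(M) = 2M - 1$ if and only if $$\frac{2M}{M+1} \leq I(M) < \frac{2M+1}{M+1}.$$
   Context: For a positive integer $n$, $\sigma(n)$ denotes the sum of the positive divisors of $n$, and $I(n) = \sigma(n)/n$ is the abundancy index of $n$. -}

module Defs where

open import Data.Nat using (ℕ; suc; _+_; _*_; NonZero)
open import Data.Nat.Divisibility using (_∣_; _∣?_)
open import Data.List using (List; filter; map; upTo)
open import Data.Nat.ListAction using (sum)
open import Data.Integer using (+_)
open import Data.Rational using (ℚ; _/_)

divisors : ℕ → List ℕ
divisors n = filter (_∣? n) (map suc (upTo n))

σ : ℕ → ℕ
σ n = sum (divisors n)

I : (n : ℕ) → .{{NonZero n}} → ℚ
I n = (+ σ n) / n

{-# OPTIONS --safe #-}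
module Submission where

-- Nothing about σ is used: for any natural s, clearing denominators turns the two bounds on
-- s/M into 2M² ≤ s(M+1) and s(M+1) < (2M+1)M. Since (2M−2)(M+1) < 2M² ≤ (2M−1)(M+1), the
-- first says s ≥ 2M−1; since (2M−1)(M+1) < (2M+1)M ≤ 2M(M+1), the second says s ≤ 2M−1.

open import Defs
open import Data.Nat using (ℕ; suc; _+_; _*_; _∸_)
open import Data.Integer using (+_)
open import Data.Rational using (_/_; _≤_; _<_)
open import Data.Product using (_×_; _,_)
open import Relation.Binary.PropositionalEquality using (_≡_; refl; sym; subst; subst₂)
open import Function.Bundles using (_⇔_; mk⇔)
open import Function.Properties.Equivalence using () renaming (sym to ⇔-sym; trans to ⇔-trans)
open import Data.Product.Function.NonDependent.Propositional using (_×-⇔_)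
open import Data.Nat.Tactic.RingSolver using (solve-∀)
import Data.Nat as ℕ
import Data.Nat.Properties as ℕ
import Data.Integer as ℤ
import Data.Integer.Properties as ℤ
import Data.Rational as ℚ
import Data.Rational.Properties as ℚ
import Data.Rational.Unnormalised as ℚᵘ
import Data.Rational.Unnormalised.Properties as ℚᵘ

fromℚᵘ-≤⇔ : ∀ x y → ℚ.fromℚᵘ x ≤ ℚ.fromℚᵘ y ⇔ x ℚᵘ.≤ y
fromℚᵘ-≤⇔ x y = mk⇔
  (λ le → ℚᵘ.≤-respˡ-≃ (ℚ.toℚᵘ-fromℚᵘ x) (ℚᵘ.≤-respʳ-≃ (ℚ.toℚᵘ-fromℚᵘ y) (ℚ.toℚᵘ-mono-≤ le)))
  (λ le → ℚ.toℚᵘ-cancel-≤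
    (ℚᵘ.≤-respˡ-≃ (ℚᵘ.≃-sym (ℚ.toℚᵘ-fromℚᵘ x)) (ℚᵘ.≤-respʳ-≃ (ℚᵘ.≃-sym (ℚ.toℚᵘ-fromℚᵘ y)) le)))

fromℚᵘ-<⇔ : ∀ x y → ℚ.fromℚᵘ x < ℚ.fromℚᵘ y ⇔ x ℚᵘ.< y
fromℚᵘ-<⇔ x y = mk⇔
  (λ lt → ℚᵘ.<-respˡ-≃ (ℚ.toℚᵘ-fromℚᵘ x) (ℚᵘ.<-respʳ-≃ (ℚ.toℚᵘ-fromℚᵘ y) (ℚ.toℚᵘ-mono-< lt)))
  (λ lt → ℚ.toℚᵘ-cancel-<
    (ℚᵘ.<-respˡ-≃ (ℚᵘ.≃-sym (ℚ.toℚᵘ-fromℚᵘ x)) (ℚᵘ.<-respʳ-≃ (ℚᵘ.≃-sym (ℚ.toℚᵘ-fromℚᵘ y)) lt)))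

/-≤-/⇔ : ∀ p q b d → p / suc b ≤ q / suc d ⇔ p ℤ.* + suc d ℤ.≤ q ℤ.* + suc b
/-≤-/⇔ p q b d = ⇔-trans (fromℚᵘ-≤⇔ (ℚᵘ.mkℚᵘ p b) (ℚᵘ.mkℚᵘ q d)) (mk⇔ ℚᵘ.drop-*≤* ℚᵘ.*≤*)

/-<-/⇔ : ∀ p q b d → p / suc b < q / suc d ⇔ p ℤ.* + suc d ℤ.< q ℤ.* + suc b
/-<-/⇔ p q b d = ⇔-trans (fromℚᵘ-<⇔ (ℚᵘ.mkℚᵘ p b) (ℚᵘ.mkℚᵘ q d)) (mk⇔ ℚᵘ.drop-*<* ℚᵘ.*<*)

pos-≤-pos⇔ : ∀ a b c d → + a ℤ.* + b ℤ.≤ + c ℤ.* + d ⇔ a * b ℕ.≤ c * d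
pos-≤-pos⇔ a b c d = mk⇔
  (λ le → ℤ.drop‿+≤+ (subst₂ ℤ._≤_ (sym (ℤ.pos-* a b)) (sym (ℤ.pos-* c d)) le))
  (λ le → subst₂ ℤ._≤_ (ℤ.pos-* a b) (ℤ.pos-* c d) (ℤ.+≤+ le))

pos-<-pos⇔ : ∀ a b c d → + a ℤ.* + b ℤ.< + c ℤ.* + d ⇔ a * b ℕ.< c * d
pos-<-pos⇔ a b c d = mk⇔
  (λ lt → ℤ.drop‿+<+ (subst₂ ℤ._<_ (sym (ℤ.pos-* a b)) (sym (ℤ.pos-* c d)) lt))
  (λ lt → subst₂ ℤ._<_ (ℤ.pos-* a b) (ℤ.pos-* c d) (ℤ.+<+ lt))

+/-≤-+/⇔ : ∀ a c b d → + a / suc b ≤ + c / suc d ⇔ a * suc d ℕ.≤ c * suc b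
+/-≤-+/⇔ a c b d = ⇔-trans (/-≤-/⇔ (+ a) (+ c) b d) (pos-≤-pos⇔ a (suc d) c (suc b))

+/-<-+/⇔ : ∀ a c b d → + a / suc b < + c / suc d ⇔ a * suc d ℕ.< c * suc b
+/-<-+/⇔ a c b d = ⇔-trans (/-<-/⇔ (+ a) (+ c) b d) (pos-<-pos⇔ a (suc d) c (suc b))

m+n≡o⇒m≤o : ∀ {m n o} → m + n ≡ o → m ℕ.≤ o
m+n≡o⇒m≤o {m} {n} eq = subst (m ℕ.≤_) eq (ℕ.m≤m+n m n)

≤-*-bracket⇔ : ∀ {u k a} s → u * k ℕ.< a → a ℕ.≤ suc u * k → a ℕ.≤ s * k ⇔ u ℕ.< s
≤-*-bracket⇔ {u} {k} s uk<a a≤u+1k = mk⇔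
  (λ a≤sk → ℕ.*-cancelʳ-< k u s (ℕ.<-≤-trans uk<a a≤sk))
  (λ u<s → ℕ.≤-trans a≤u+1k (ℕ.*-monoˡ-≤ k u<s))

*-<-bracket⇔ : ∀ {t k b} s → t * k ℕ.< b → b ℕ.≤ suc t * k → s * k ℕ.< b ⇔ s ℕ.≤ t
*-<-bracket⇔ {t} {k} s tk<b b≤t+1k = mk⇔
  (λ sk<b → ℕ.≤-pred (ℕ.*-cancelʳ-< k s (suc t) (ℕ.<-≤-trans sk<b b≤t+1k)))
  (λ s≤t → ℕ.≤-<-trans (ℕ.*-monoˡ-≤ k s≤t) tk<b)

≡⇔≥×≤ : ∀ {s t} → s ≡ t ⇔ (t ℕ.≤ s × s ℕ.≤ t)
≡⇔≥×≤ = mk⇔ (λ { refl → ℕ.≤-refl , ℕ.≤-refl }) (λ (t≤s , s≤t) → ℕ.≤-antisym s≤t t≤s)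

2[1+m]∸1≡1+2m : ∀ m → 2 * suc m ∸ 1 ≡ suc (2 * m)
2[1+m]∸1≡1+2m m = ℕ.+-suc m (m + 0)

lower-bound⇔ : ∀ m s → 2 * suc m * suc m ℕ.≤ s * (suc m + 1) ⇔ 2 * m ℕ.< s
lower-bound⇔ m s = ≤-*-bracket⇔ s (m+n≡o⇒m≤o (below m)) (m+n≡o⇒m≤o (above m))
  where
  below : ∀ m → suc (2 * m * (suc m + 1)) + 1 ≡ 2 * suc m * suc m
  below = solve-∀
  above : ∀ m → 2 * suc m * suc m + m ≡ suc (2 * m) * (suc m + 1)
  above = solve-∀

upper-bound⇔ : ∀ m s → s * (suc m + 1) ℕ.< (2 * suc m + 1) * suc m ⇔ s ℕ.≤ suc (2 * m)
upper-bound⇔ m s = *-<-bracket⇔ s (ℕ.≤-reflexive (below m)) (m+n≡o⇒m≤o (above m))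
  where
  below : ∀ m → suc (suc (2 * m) * (suc m + 1)) ≡ (2 * suc m + 1) * suc m
  below = solve-∀
  above : ∀ m → (2 * suc m + 1) * suc m + suc m ≡ suc (suc (2 * m)) * (suc m + 1)
  above = solve-∀

theorem2 : (m : ℕ) → let M = suc m in
    (σ M ≡ 2 * M ∸ 1) ⇔
      (((+ (2 * M)) / (M + 1) ≤ I M) × (I M < (+ (2 * M + 1)) / (M + 1)))
theorem2 m = subst (λ t → (σ M ≡ t) ⇔ Bounds) (sym (2[1+m]∸1≡1+2m m))
  (⇔-trans ≡⇔≥×≤ (⇔-sym
    (⇔-trans (+/-≤-+/⇔ (2 * M) (σ M) (m + 1) m ×-⇔ +/-<-+/⇔ (σ M) (2 * M + 1) m (m + 1))
             (lower-bound⇔ m (σ M) ×-⇔ upper-bound⇔ m (σ M)))))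
  where
  M = suc m
  Bounds : Set
  Bounds = ((+ (2 * M)) / (M + 1) ≤ I M) × (I M < (+ (2 * M + 1)) / (M + 1))
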